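{- Let $p$ be a prime such that $2p+1$ and $p+2$ are also prime, and let $k=2p-1$. Then the permutation $\sigma$ of $[k]$ given by $\sigma(k)=1$, $\sigma(k-1)=2$, $\sigma(p)=p$, $\sigma(p-2)=p+2$, and $\sigma(i)=i+2$ for all other $i\in[k]$, is weakly consecutive.
   Context: $[k]=\{1,\dots,k\}$. A permutation $\sigma:[k]\to[k]$ is weakly consecutive if for all $i,j\in[k]$ and all integers $m$, whenever $m\mid\sigma(i)$ and $m\mid(i-j)$, also $m\mid\sigma(j)$. -}

module Defs where

open import Data.Nat using (ℕ; suc; _+_; _*_; _∸_; _≤_; _≟_)
open import Data.Integer as ℤ using (ℤ; +_)
open import Data.Integer.Divisibility using () renaming (_∣_ to _∣ℤ_)
open import Data.Product using (_×_)
open import Relation.Nullary.Decidable using (does)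
open import Data.Bool using (if_then_else_)
open import Relation.Binary.PropositionalEquality using (_≡_)

InRange : ℕ → ℕ → Set
InRange k i = 1 ≤ i × i ≤ k

-- σ : [k] → [k] is a permutation of [k] (represented as a function ℕ → ℕ,
-- only its values on [k] matter)
IsPermutation : ℕ → (ℕ → ℕ) → Set
IsPermutation k σ =
  (∀ i → InRange k i → InRange k (σ i)) ×
  (∀ i j → InRange k i → InRange k j → σ i ≡ σ j → i ≡ j)

WeaklyConsecutive : ℕ → (ℕ → ℕ) → Set
WeaklyConsecutive k σ =
  ∀ i j → InRange k i → InRange k j → (m : ℤ) →
    m ∣ℤ (+ σ i) → m ∣ℤ ((+ i) ℤ.- (+ j)) → m ∣ℤ (+ σ j)

sigmaP : ℕ → ℕ → ℕ
sigmaP p i =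
  if does (i ≟ (2 * p ∸ 1)) then 1 else
  if does (i ≟ (2 * p ∸ 2)) then 2 else
  if does (i ≟ p) then p else
  if does (i ≟ (p ∸ 2)) then p + 2 else
  i + 2

-- Only |m| matters, so fix a modulus a ≥ 0. If a ≥ k, a difference i − j of points of [k] divisible
-- by a vanishes. If a is p or p + 2, the only value of σ divisible by a is a itself, taken at p resp.
-- p − 2, and every point of [k] lies at distance < a from there. For every other a < k we have
-- a ∣ σ(x) ⇔ a ∣ x + 2 on all of [k]: at the four exceptional points this is where the primality of
-- p, p + 2 and 2p + 1 enters, since σ(x) and x + 2 are then (1, 2p + 1), (2, 2p), (p, p + 2) or
-- (p + 2, p). A translation visibly preserves divisibility of differences.
module Submission where

open import Defs
open import Data.Nat
open import Data.Nat.Properties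
open import Data.Nat.Divisibility
open import Data.Nat.Primality
open import Data.Nat.Coprimality using (coprime-divisor; prime⇒coprime) renaming (sym to coprime-sym)
import Data.Integer as ℤ
open import Data.Integer.Properties using (m-n≡m⊖n; ∣⊖∣-≤; ∣m⊖n∣≡∣n⊖m∣)
open import Data.Integer.Divisibility using () renaming (_∣_ to _∣ℤ_)
open import Data.Integer.Divisibility.Signed using (∣ᵤ⇒∣; ∣⇒∣ᵤ; ∣m∣n⇒∣m-n) renaming (_∣_ to _∣ˢ_)
open import Data.Integer.Tactic.RingSolver using (solve-∀)
open import Data.Product using (_×_; _,_; proj₁; proj₂)
open import Data.Sum using (inj₁; inj₂; [_,_]′)
open import Data.Bool using (if_then_else_)
open import Function.Base using (_∘_)
open import Function.Bundles using (_⇔_; mk⇔; Equivalence)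
import Function.Properties.Equivalence as ⇔
open import Relation.Nullary using (¬_; Dec; yes; no; does; contradiction)
open import Relation.Nullary.Decidable using (dec-true; dec-false)
open import Relation.Binary.PropositionalEquality
open import Relation.Binary.Definitions using (tri<; tri≈; tri>)

open Equivalence using (to; from)

m∣n∧n<m⇒n≡0 : ∀ {m n} → m ∣ n → n < m → n ≡ 0
m∣n∧n<m⇒n≡0 {n = zero}  _   _   = refl
m∣n∧n<m⇒n≡0 {n = suc _} m∣n n<m = contradiction m∣n (>⇒∤ n<m)

m∣n∧0<n<2m⇒n≡m : ∀ {m n} → m ∣ n → 0 < n → n < 2 * m → n ≡ m
m∣n∧0<n<2m⇒n≡m     (divides zero          refl) () _
m∣n∧0<n<2m⇒n≡m {m} (divides (suc zero)    refl) _  _ = +-identityʳ m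
m∣n∧0<n<2m⇒n≡m {m} (divides (suc (suc c)) refl) _  n<2m =
  contradiction n<2m (≤⇒≯ (+-monoʳ-≤ m (≤-trans (≤-reflexive (+-identityʳ m)) (m≤m+n m (c * m)))))

∣m-n∣<o : ∀ m n {o} → m < n + o → n < m + o → ∣ m - n ∣ < o
∣m-n∣<o zero    n       _   n<o = n<o
∣m-n∣<o (suc m) zero    m<o _   = m<o
∣m-n∣<o (suc m) (suc n) lt₁ lt₂ = ∣m-n∣<o m n (s<s⁻¹ lt₁) (s<s⁻¹ lt₂)

∣+m-+n∣≡∣m-n∣ : ∀ m n → ℤ.∣ ℤ.+ m ℤ.- ℤ.+ n ∣ ≡ ∣ m - n ∣
∣+m-+n∣≡∣m-n∣ m n with ≤-total m n
... | inj₁ m≤n = begin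
  ℤ.∣ ℤ.+ m ℤ.- ℤ.+ n ∣ ≡⟨ cong ℤ.∣_∣ (m-n≡m⊖n m n) ⟩
  ℤ.∣ m ℤ.⊖ n ∣         ≡⟨ ∣⊖∣-≤ m≤n ⟩
  n ∸ m                 ≡⟨ m≤n⇒∣m-n∣≡n∸m m≤n ⟨
  ∣ m - n ∣             ∎
  where open ≡-Reasoning
... | inj₂ n≤m = begin
  ℤ.∣ ℤ.+ m ℤ.- ℤ.+ n ∣ ≡⟨ cong ℤ.∣_∣ (m-n≡m⊖n m n) ⟩
  ℤ.∣ m ℤ.⊖ n ∣         ≡⟨ ∣m⊖n∣≡∣n⊖m∣ m n ⟩
  ℤ.∣ n ℤ.⊖ m ∣         ≡⟨ ∣⊖∣-≤ n≤m ⟩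
  m ∸ n                 ≡⟨ m≤n⇒∣n-m∣≡n∸m n≤m ⟨
  ∣ m - n ∣             ∎
  where open ≡-Reasoning

o∣m-n∧∣m-n∣<o⇒m≡n : ∀ {m n o} → ℤ.+ o ∣ℤ ℤ.+ m ℤ.- ℤ.+ n → ∣ m - n ∣ < o → m ≡ n
o∣m-n∧∣m-n∣<o⇒m≡n {m} {n} {o} o∣m-n ∣m-n∣<o =
  ∣m-n∣≡0⇒m≡n (m∣n∧n<m⇒n≡0 (subst (o ∣_) (∣+m-+n∣≡∣m-n∣ m n) o∣m-n) ∣m-n∣<o)

∣m+o∧∣m-n⇒∣n+o : ∀ {d m n o} → d ∣ℤ m ℤ.+ o → d ∣ℤ m ℤ.- n → d ∣ℤ n ℤ.+ o
∣m+o∧∣m-n⇒∣n+o {d} {m} {n} {o} d∣m+o d∣m-n =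
  ∣⇒∣ᵤ (subst (d ∣ˢ_) (difference m n o)
    (∣m∣n⇒∣m-n (∣ᵤ⇒∣ {d} {m ℤ.+ o} d∣m+o) (∣ᵤ⇒∣ {d} {m ℤ.- n} d∣m-n)))
  where
  difference : ∀ m n o → (m ℤ.+ o) ℤ.- (m ℤ.- n) ≡ n ℤ.+ o
  difference = solve-∀

∣1⇔∣prime : ∀ {d q} → Prime q → d ≢ q → d ∣ 1 ⇔ d ∣ q
∣1⇔∣prime {q = q} q-prime d≢q = mk⇔ (λ d∣1 → ∣-trans d∣1 (1∣ q)) (λ d∣q →
  [ ∣-reflexive , (λ d≡q → contradiction d≡q d≢q) ]′ (prime⇒irreducible q-prime d∣q))

∣prime⇔∣prime : ∀ {d p q} → Prime p → Prime q → d ≢ p → d ≢ q → d ∣ p ⇔ d ∣ q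
∣prime⇔∣prime p-prime q-prime d≢p d≢q =
  ⇔.trans (⇔.sym (∣1⇔∣prime p-prime d≢p)) (∣1⇔∣prime q-prime d≢q)

∣2⇔∣2*prime : ∀ {d p} → Prime p → d ≢ p → d < 2 * p → d ∣ 2 ⇔ d ∣ 2 * p
∣2⇔∣2*prime {d} {p} p-prime d≢p d<2p = mk⇔ (∣m⇒∣m*n p) ∣2p⇒∣2
  where
  0<2p : 0 < 2 * p
  0<2p = *-monoʳ-< 2 (n≢0⇒n>0 (≢-nonZero⁻¹ p {{prime⇒nonZero p-prime}}))
  ∣2p⇒∣2 : d ∣ 2 * p → d ∣ 2
  ∣2p⇒∣2 d∣2p with <-cmp d p
  ... | tri< d<p _ _ =
    coprime-divisor (coprime-sym (prime⇒coprime p-prime {{≢-nonZero d≢0}} d<p)) (subst (d ∣_) (*-comm 2 p) d∣2p)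
    where
    d≢0 : d ≢ 0
    d≢0 refl = >⇒≢ 0<2p (0∣⇒≡0 d∣2p)
  ... | tri≈ _ d≡p _ = contradiction d≡p d≢p
  ... | tri> _ _ p<d = contradiction (m∣n∧0<n<2m⇒n≡m d∣2p 0<2p (*-monoʳ-< 2 p<d)) (>⇒≢ d<2p)

WeaklyConsecutiveAt : ℕ → (ℕ → ℕ) → ℕ → Set
WeaklyConsecutiveAt k σ a =
  ∀ i j → InRange k i → InRange k j → a ∣ σ i → ℤ.+ a ∣ℤ ℤ.+ i ℤ.- ℤ.+ j → a ∣ σ j

weaklyConsecutive : ∀ {k σ} → (∀ a → WeaklyConsecutiveAt k σ a) → WeaklyConsecutive k σ
weaklyConsecutive consecutiveAt i j i∈k j∈k m = consecutiveAt ℤ.∣ m ∣ i j i∈k j∈k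

∣i-j∣<k : ∀ {k i j} → InRange k i → InRange k j → ∣ i - j ∣ < k
∣i-j∣<k {k} {i} {j} (1≤i , i≤k) (1≤j , j≤k) =
  ∣m-n∣<o i j (<-≤-trans (s≤s i≤k) (+-monoˡ-≤ k 1≤j)) (<-≤-trans (s≤s j≤k) (+-monoˡ-≤ k 1≤i))

weaklyConsecutiveAt-≥ : ∀ {k σ a} → k ≤ a → WeaklyConsecutiveAt k σ a
weaklyConsecutiveAt-≥ {σ = σ} {a} k≤a i j i∈k j∈k a∣σi a∣i-j =
  subst (λ x → a ∣ σ x) (o∣m-n∧∣m-n∣<o⇒m≡n a∣i-j (<-≤-trans (∣i-j∣<k i∈k j∈k) k≤a)) a∣σi

-- The value a = σ c is the only multiple of a in [k], and every point of [k] is within distance < a of c.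
weaklyConsecutiveAt-attained : ∀ {k σ a c} → IsPermutation k σ → InRange k c → σ c ≡ a →
  c ≤ a → k < c + a → WeaklyConsecutiveAt k σ a
weaklyConsecutiveAt-attained {k} {σ} {a} {c} (range , injective) c∈k σc≡a c≤a k<c+a
  i j i∈k j∈k a∣σi a∣i-j = subst (λ x → a ∣ σ x) i≡j a∣σi
  where
  c+a≤2a : c + a ≤ 2 * a
  c+a≤2a = ≤-trans (+-monoˡ-≤ a c≤a) (≤-reflexive (cong (a +_) (sym (+-identityʳ a))))
  σi≡a : σ i ≡ a
  σi≡a = m∣n∧0<n<2m⇒n≡m a∣σi (proj₁ (range i i∈k))
    (≤-<-trans (proj₂ (range i i∈k)) (<-≤-trans k<c+a c+a≤2a))
  i≡c : i ≡ c
  i≡c = injective i c i∈k c∈k (trans σi≡a (sym σc≡a))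
  i≡j : i ≡ j
  i≡j = o∣m-n∧∣m-n∣<o⇒m≡n a∣i-j (subst (λ x → ∣ x - j ∣ < a) (sym i≡c)
    (∣m-n∣<o c j (≤-trans (s≤s c≤a) (+-monoˡ-≤ a (proj₁ j∈k))) (≤-<-trans (proj₂ j∈k) k<c+a)))

weaklyConsecutiveAt-shift : ∀ {k σ a s} → (∀ x → InRange k x → a ∣ σ x ⇔ a ∣ x + s) →
  WeaklyConsecutiveAt k σ a
weaklyConsecutiveAt-shift {a = a} {s} shift i j i∈k j∈k a∣σi a∣i-j =
  from (shift j j∈k) (∣m+o∧∣m-n⇒∣n+o {ℤ.+ a} {ℤ.+ i} {ℤ.+ j} {ℤ.+ s} (to (shift i i∈k) a∣σi) a∣i-j)

if-yes : ∀ {P A : Set} {x y : A} (P? : Dec P) → P → (if does P? then x else y) ≡ x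
if-yes P? p = cong (if_then _ else _) (dec-true P? p)

if-no : ∀ {P A : Set} {x y : A} (P? : Dec P) → ¬ P → (if does P? then x else y) ≡ y
if-no P? ¬p = cong (if_then _ else _) (dec-false P? ¬p)

-- Primality of p and p + 2 forces p ≥ 3; writing p = 3 + q makes p ∸ 2 reduce to suc q and
-- 2 * p to suc k, so no truncated subtraction has to be reasoned about.
module Sigma (q : ℕ) where

  p k k′ : ℕ
  p  = 3 + q
  k  = 2 * p ∸ 1
  k′ = 2 * p ∸ 2

  σ : ℕ → ℕ
  σ = sigmaP p

  p<k′ : p < k′
  p<k′ = s≤s (≤-trans (≤-reflexive (cong (3 +_) (sym (+-identityʳ q)))) (m≤n+m (3 + (q + 0)) q))

  p≤k : p ≤ k
  p≤k = ≤-trans (<⇒≤ p<k′) (n≤1+n k′)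

  p+2≤k : p + 2 ≤ k
  p+2≤k = subst (_≤ k) (+-comm 2 p) (s≤s p<k′)

  p∸2<p : p ∸ 2 < p
  p∸2<p = m<n⇒m<1+n (n<1+n (suc q))

  data SigmaCase : ℕ → Set where
    at-k      : σ k ≡ 1 → SigmaCase k
    at-k′     : σ k′ ≡ 2 → SigmaCase k′
    at-p      : σ p ≡ p → SigmaCase p
    at-p∸2    : σ (p ∸ 2) ≡ p + 2 → SigmaCase (p ∸ 2)
    elsewhere : ∀ {x} → x ≢ k → x ≢ k′ → x ≢ p → x ≢ p ∸ 2 → σ x ≡ x + 2 → SigmaCase x

  sigmaCase : ∀ x → SigmaCase x
  sigmaCase x with x ≟ k
  ... | yes refl = at-k (if-yes (k ≟ k) refl)
  ... | no x≢k with x ≟ k′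
  ... | yes refl = at-k′ (trans (if-no (k′ ≟ k) x≢k) (if-yes (k′ ≟ k′) refl))
  ... | no x≢k′ with x ≟ p
  ... | yes refl = at-p (trans (if-no (p ≟ k) x≢k) (trans (if-no (p ≟ k′) x≢k′) (if-yes (p ≟ p) refl)))
  ... | no x≢p with x ≟ p ∸ 2
  ... | yes refl = at-p∸2 (trans (if-no (p ∸ 2 ≟ k) x≢k) (trans (if-no (p ∸ 2 ≟ k′) x≢k′)
                     (trans (if-no (p ∸ 2 ≟ p) x≢p) (if-yes (p ∸ 2 ≟ p ∸ 2) refl))))
  ... | no x≢p∸2 = elsewhere x≢k x≢k′ x≢p x≢p∸2
                     (trans (if-no (x ≟ k) x≢k) (trans (if-no (x ≟ k′) x≢k′)
                     (trans (if-no (x ≟ p) x≢p) (if-no (x ≟ p ∸ 2) x≢p∸2))))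

  2p≡[p∸2]+[p+2] : 2 * p ≡ (p ∸ 2) + (p + 2)
  2p≡[p∸2]+[p+2] = begin
    2 * p             ≡⟨ cong (p +_) (+-identityʳ p) ⟩
    p + p             ≡⟨ cong (_+ p) (+-comm 2 (p ∸ 2)) ⟩
    (p ∸ 2) + 2 + p   ≡⟨ +-assoc (p ∸ 2) 2 p ⟩
    (p ∸ 2) + (2 + p) ≡⟨ cong ((p ∸ 2) +_) (+-comm 2 p) ⟩
    (p ∸ 2) + (p + 2) ∎
    where open ≡-Reasoning

  σ-p : σ p ≡ p
  σ-p = trans (if-no (p ≟ k) (<⇒≢ (m<n⇒m<1+n p<k′)))
    (trans (if-no (p ≟ k′) (<⇒≢ p<k′)) (if-yes (p ≟ p) refl))

  σ-p∸2 : σ (p ∸ 2) ≡ p + 2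
  σ-p∸2 = trans (if-no (p ∸ 2 ≟ k) (<⇒≢ (<-trans p∸2<p (m<n⇒m<1+n p<k′))))
    (trans (if-no (p ∸ 2 ≟ k′) (<⇒≢ (<-trans p∸2<p p<k′)))
    (trans (if-no (p ∸ 2 ≟ p) (<⇒≢ p∸2<p)) (if-yes (p ∸ 2 ≟ p ∸ 2) refl)))

  σ-range : ∀ x → InRange k x → InRange k (σ x)
  σ-range x x∈k with sigmaCase x
  ... | at-k σk≡1 rewrite σk≡1 = s≤s z≤n , s≤s z≤n
  ... | at-k′ σk′≡2 rewrite σk′≡2 = s≤s z≤n , s≤s (s≤s z≤n)
  ... | at-p σp≡p rewrite σp≡p = s≤s z≤n , p≤k
  ... | at-p∸2 σp∸2≡p+2 rewrite σp∸2≡p+2 = s≤s z≤n , p+2≤k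
  ... | elsewhere x≢k x≢k′ _ _ σx≡x+2 rewrite σx≡x+2 =
    ≤-trans (proj₁ x∈k) (m≤m+n x 2) , subst (_≤ k) (+-comm 2 x) (s≤s x<k′)
    where
    x<k′ : x < k′
    x<k′ = ≤∧≢⇒< (s≤s⁻¹ (≤∧≢⇒< (proj₂ x∈k) x≢k)) x≢k′

  σ⁻¹ : ℕ → ℕ
  σ⁻¹ v =
    if does (v ≟ 1) then k else
    if does (v ≟ 2) then k′ else
    if does (v ≟ p) then p else
    if does (v ≟ p + 2) then p ∸ 2 else
    v ∸ 2

  σ⁻¹-σ : ∀ x → 1 ≤ x → σ⁻¹ (σ x) ≡ x
  σ⁻¹-σ x 1≤x with sigmaCase x
  ... | at-k σk≡1 rewrite σk≡1 = refl
  ... | at-k′ σk′≡2 rewrite σk′≡2 = refl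
  ... | at-p σp≡p rewrite σp≡p = if-yes (p ≟ p) refl
  ... | at-p∸2 σp∸2≡p+2 rewrite σp∸2≡p+2 =
    trans (if-no (p + 2 ≟ p) p+2≢p) (if-yes (p + 2 ≟ p + 2) refl)
    where
    p+2≢p : p + 2 ≢ p
    p+2≢p = >⇒≢ (m<m+n p (s≤s z≤n))
  ... | elsewhere _ _ x≢p x≢p∸2 σx≡x+2 rewrite σx≡x+2 =
    trans (if-no (x + 2 ≟ 1) (>⇒≢ (<-trans (s≤s (s≤s z≤n)) 2<x+2)))
      (trans (if-no (x + 2 ≟ 2) (>⇒≢ 2<x+2))
      (trans (if-no (x + 2 ≟ p) x+2≢p)
      (trans (if-no (x + 2 ≟ p + 2) (x≢p ∘ +-cancelʳ-≡ 2 x p)) (m+n∸n≡m x 2))))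
    where
    2<x+2 : 2 < x + 2
    2<x+2 = +-monoˡ-≤ 2 1≤x
    x+2≢p : x + 2 ≢ p
    x+2≢p x+2≡p = x≢p∸2 (+-cancelʳ-≡ 2 x (p ∸ 2) (trans x+2≡p (+-comm 2 (p ∸ 2))))

  σ-injective : ∀ x y → InRange k x → InRange k y → σ x ≡ σ y → x ≡ y
  σ-injective x y x∈k y∈k σx≡σy = begin
    x           ≡⟨ σ⁻¹-σ x (proj₁ x∈k) ⟨
    σ⁻¹ (σ x)   ≡⟨ cong σ⁻¹ σx≡σy ⟩
    σ⁻¹ (σ y)   ≡⟨ σ⁻¹-σ y (proj₁ y∈k) ⟩
    y           ∎
    where open ≡-Reasoning

  σ-isPermutation : IsPermutation k σ
  σ-isPermutation = σ-range , σ-injective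

  module _ (p-prime : Prime p) (2p+1-prime : Prime (2 * p + 1)) (p+2-prime : Prime (p + 2)) where

    σ-∣-shift : ∀ {a} → a ≢ p → a ≢ p + 2 → a < 2 * p → ∀ x → InRange k x → a ∣ σ x ⇔ a ∣ x + 2
    σ-∣-shift {a} a≢p a≢p+2 a<2p x _ with sigmaCase x
    ... | at-k σk≡1 rewrite σk≡1 | +-suc k 1 =
      ∣1⇔∣prime 2p+1-prime (<⇒≢ (<-≤-trans a<2p (m≤m+n (2 * p) 1)))
    ... | at-k′ σk′≡2 rewrite σk′≡2 | +-comm k′ 2 = ∣2⇔∣2*prime p-prime a≢p a<2p
    ... | at-p σp≡p rewrite σp≡p = ∣prime⇔∣prime p-prime p+2-prime a≢p a≢p+2
    ... | at-p∸2 σp∸2≡p+2 rewrite σp∸2≡p+2 | +-comm (p ∸ 2) 2 =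
      ∣prime⇔∣prime p+2-prime p-prime a≢p+2 a≢p
    ... | elsewhere _ _ _ _ σx≡x+2 rewrite σx≡x+2 = ⇔.refl

    σ-weaklyConsecutiveAt : ∀ a → WeaklyConsecutiveAt k σ a
    σ-weaklyConsecutiveAt a with k ≤? a
    ... | yes k≤a = weaklyConsecutiveAt-≥ k≤a
    ... | no k≰a with a ≟ p
    ... | yes refl = weaklyConsecutiveAt-attained σ-isPermutation (s≤s z≤n , p≤k) σ-p ≤-refl
                       (≤-reflexive (cong (p +_) (+-identityʳ p)))
    ... | no a≢p with a ≟ p + 2
    ... | yes refl = weaklyConsecutiveAt-attained σ-isPermutation (s≤s z≤n , ≤-trans (<⇒≤ p∸2<p) p≤k) σ-p∸2
                       (≤-trans (<⇒≤ p∸2<p) (m≤m+n p 2)) (≤-reflexive 2p≡[p∸2]+[p+2])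
    ... | no a≢p+2 = weaklyConsecutiveAt-shift (σ-∣-shift a≢p a≢p+2 (m<n⇒m<1+n (≰⇒> k≰a)))

mainTheorem9 : (p : ℕ) → Prime p → Prime (2 * p + 1) → Prime (p + 2) →
    IsPermutation (2 * p ∸ 1) (sigmaP p) ×
    WeaklyConsecutive (2 * p ∸ 1) (sigmaP p)
mainTheorem9 0 0-prime _ _ = contradiction 0-prime ¬prime[0]
mainTheorem9 1 1-prime _ _ = contradiction 1-prime ¬prime[1]
mainTheorem9 2 _ _ 4-prime = contradiction 4-prime (composite⇒¬prime composite[4])
mainTheorem9 (suc (suc (suc q))) p-prime 2p+1-prime p+2-prime =
  σ-isPermutation , weaklyConsecutive (σ-weaklyConsecutiveAt p-prime 2p+1-prime p+2-prime)
  where open Sigma q
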